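{- Let $(A_n)_{n\ge1}$ and $(B_n)_{n\ge1}$ be the anti-recurrence sequence and its complementary sequence for the linear form $\mathbf a=(2,1)$ (the anti-Jacobsthal numbers), so $A_n=2B_{2n-1}+B_{2n}$, and write $B^1_n=B_{2n-1}$, $B^2_n=B_{2n}$. Then for all $n\ge1$: \[0\le A_n-7n+4\le 3,\qquad 0\le 3B^1_n-7n+6\le 4,\qquad 0\le 3B^2_n-7n+2\le 3.\]
   Context: Anti-recurrence sequence: given a vector $\mathbf a=(a_1,\ldots,a_k)$ of positive integers, $k\ge2$, $(A_n)_{n\ge1}$ and $(B_n)_{n\ge1}$ are the unique strictly increasing sequences of positive integers that are complementary (every positive integer lies in exactly one of them) and satisfy $A_n=\sum_{j=1}^k a_jB_{(n-1)k+j}$ for all $n\ge1$. For $\mathbf a=(2,1)$ the sequence begins $A=4,11,19,25,32,\ldots$. -}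

module Defs where

open import Data.Nat using (ℕ; zero; suc; _+_; _*_; _∸_; _≤_; _<_)
open import Data.Fin using (Fin; toℕ)
import Data.Fin as Fin
open import Data.Vec using (Vec; lookup; _∷_; [])
open import Data.Product using (Σ; _×_)
open import Data.Sum using (_⊎_)
open import Relation.Binary.PropositionalEquality using (_≡_; _≢_)

sumFin : (k : ℕ) → (Fin k → ℕ) → ℕ
sumFin zero    f = 0
sumFin (suc k) f = f Fin.zero + sumFin k (λ j → f (Fin.suc j))

-- Sequences are functions ℕ → ℕ, indexed from 1 (the value at index 0 is irrelevant).
StrictlyIncreasing : (ℕ → ℕ) → Set
StrictlyIncreasing S = ∀ m n → 1 ≤ m → m < n → S m < S n

PositiveSeq : (ℕ → ℕ) → Set
PositiveSeq S = ∀ n → 1 ≤ n → 1 ≤ S n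

Complementary : (ℕ → ℕ) → (ℕ → ℕ) → Set
Complementary A B =
  (∀ m → 1 ≤ m → (Σ ℕ λ n → 1 ≤ n × A n ≡ m) ⊎ (Σ ℕ λ n → 1 ≤ n × B n ≡ m))
  × (∀ i j → 1 ≤ i → 1 ≤ j → A i ≢ B j)

-- A_n = Σ_{j=1}^k a_j B_{(n-1)k+j}  for all n ≥ 1   (a_j = lookup a (j-1))
AntiRecurrenceEq : (k : ℕ) → Vec ℕ k → (ℕ → ℕ) → (ℕ → ℕ) → Set
AntiRecurrenceEq k a A B =
  ∀ n → 1 ≤ n → A n ≡ sumFin k (λ j → lookup a j * B ((n ∸ 1) * k + suc (toℕ j)))

-- (A, B) is the anti-recurrence sequence for a together with its complementary sequence
-- (these conditions determine A and B uniquely, for k ≥ 2)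
IsAntiRecurrence : (k : ℕ) → Vec ℕ k → (ℕ → ℕ) → (ℕ → ℕ) → Set
IsAntiRecurrence k a A B =
  2 ≤ k × (∀ (j : Fin k) → 1 ≤ lookup a j)
  × PositiveSeq A × PositiveSeq B
  × StrictlyIncreasing A × StrictlyIncreasing B
  × Complementary A B
  × AntiRecurrenceEq k a A B

jacobsthalForm : Vec ℕ 2
jacobsthalForm = 2 ∷ 1 ∷ []

-- Because A and B are complementary, B_m = m + k_m where k_m counts the terms of A below B_m.
-- We show 7n − 4 ≤ A_n ≤ 7n − 1 by strong induction. For n = p + 1 the windows for A_1, …, A_p
-- force p − 2 ≤ 3 k_{2p+1} ≤ p + 2 and p − 1 ≤ 3 k_{2p+2} ≤ p + 2, which are the bounds on B¹_n and
-- B²_n; substituting them into A_n = 2 B¹_n + B²_n, using k_{2p+1} ≤ k_{2p+2}, gives the window for A_n.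
module Submission where

open import Data.Nat using (ℕ)
open import Defs

module StrictlyIncreasingProperties {S : ℕ → ℕ} (S-inc : StrictlyIncreasing S) where
  open import Data.Nat
  open import Data.Nat.Properties
  open import Data.Product using (_×_; _,_)
  open import Data.Sum using (_⊎_; inj₁; inj₂)
  open import Function using (_∘_)
  open import Relation.Nullary using (yes; no; contradiction)
  open import Relation.Binary.PropositionalEquality

  mono-≤ : ∀ {i j} → 1 ≤ i → i ≤ j → S i ≤ S j
  mono-≤ 1≤i i≤j with m≤n⇒m<n∨m≡n i≤j
  ... | inj₁ i<j  = <⇒≤ (S-inc _ _ 1≤i i<j)
  ... | inj₂ refl = ≤-refl

  cancel-≤ : ∀ {i j} → 1 ≤ j → S i ≤ S j → i ≤ j
  cancel-≤ {i} {j} 1≤j Si≤Sj with j <? i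
  ... | yes j<i = contradiction Si≤Sj (<⇒≱ (S-inc j i 1≤j j<i))
  ... | no  j≮i = ≮⇒≥ j≮i

  cancel-< : ∀ {i j} → 1 ≤ j → S i < S j → i < j
  cancel-< {i} {j} 1≤j Si<Sj with j ≤? i
  ... | yes j≤i = contradiction (mono-≤ 1≤j j≤i) (<⇒≱ Si<Sj)
  ... | no  j≰i = ≰⇒> j≰i

  -- S has exactly c terms ≤ v (the disjunction is there because S 0 is not a term)
  CountUpTo : ℕ → ℕ → Set
  CountUpTo v c = (c ≡ 0 ⊎ S c ≤ v) × v < S (suc c)

  count-next-index : ∀ {v c n} → CountUpTo v c → 1 ≤ n → S n ≡ suc v → n ≡ suc c
  count-next-index {v} {c} {n} (below , above) 1≤n Sn≡1+v =
    ≤-antisym (cancel-≤ z<s (subst (_≤ S (suc c)) (sym Sn≡1+v) above)) (c<n below)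
    where
    c<n : c ≡ 0 ⊎ S c ≤ v → c < n
    c<n (inj₁ refl) = 1≤n
    c<n (inj₂ Sc≤v) = cancel-< 1≤n (subst (S c <_) (sym Sn≡1+v) (s≤s Sc≤v))

  count-at-term : ∀ {v c} → S (suc c) ≡ suc v → CountUpTo (suc v) (suc c)
  count-at-term {v} {c} S[1+c]≡1+v =
    inj₂ (≤-reflexive S[1+c]≡1+v) ,
    subst (_< S (2 + c)) S[1+c]≡1+v (S-inc (suc c) (2 + c) z<s ≤-refl)

  count-at-nonterm : ∀ {v c} → CountUpTo v c → S (suc c) ≢ suc v → CountUpTo (suc v) c
  count-at-nonterm (below , above) S[1+c]≢1+v = weaken below , ≤∧≢⇒< above (S[1+c]≢1+v ∘ sym)
    where
    weaken : ∀ {c v} → c ≡ 0 ⊎ S c ≤ v → c ≡ 0 ⊎ S c ≤ suc v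
    weaken (inj₁ c≡0)  = inj₁ c≡0
    weaken (inj₂ Sc≤v) = inj₂ (m≤n⇒m≤1+n Sc≤v)

  count-of-term : ∀ {m c} → 1 ≤ m → CountUpTo (S m) c → c ≡ m
  count-of-term {m} {c} 1≤m (below , above) = ≤-antisym (c≤m below) (≤-pred (cancel-< z<s above))
    where
    c≤m : c ≡ 0 ⊎ S c ≤ S m → c ≤ m
    c≤m (inj₁ refl)  = z≤n
    c≤m (inj₂ Sc≤Sm) = cancel-≤ 1≤m Sc≤Sm

module ComplementaryProperties
  {A B : ℕ → ℕ} (A-pos : PositiveSeq A) (B-pos : PositiveSeq B)
  (A-inc : StrictlyIncreasing A) (B-inc : StrictlyIncreasing B) (A∁B : Complementary A B) where
  open import Data.Nat
  open import Data.Nat.Properties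
  open import Data.Product using (_×_; _,_; proj₁; proj₂; ∃; ∃₂)
  open import Data.Sum using (_⊎_; inj₁; inj₂)
  open import Relation.Binary.PropositionalEquality

  module Aᵢ = StrictlyIncreasingProperties A-inc
  module Bᵢ = StrictlyIncreasingProperties B-inc

  no-common-term : ∀ {i j v} → A (suc i) ≡ v → B (suc j) ≢ v
  no-common-term A[1+i]≡v B[1+j]≡v = proj₂ A∁B _ _ z<s z<s (trans A[1+i]≡v (sym B[1+j]≡v))

  counts : ∀ v → ∃₂ λ a b → a + b ≡ v × Aᵢ.CountUpTo v a × Bᵢ.CountUpTo v b
  counts zero = 0 , 0 , refl , (inj₁ refl , A-pos 1 z<s) , (inj₁ refl , B-pos 1 z<s)
  counts (suc v) with counts v | proj₁ A∁B (suc v) z<s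
  ... | a , b , a+b≡v , countA , countB | inj₁ (n , 1≤n , An≡1+v) =
    suc a , b , cong suc a+b≡v ,
    Aᵢ.count-at-term A[1+a]≡1+v , Bᵢ.count-at-nonterm countB (no-common-term A[1+a]≡1+v)
    where
    A[1+a]≡1+v : A (suc a) ≡ suc v
    A[1+a]≡1+v = subst (λ i → A i ≡ suc v) (Aᵢ.count-next-index countA 1≤n An≡1+v) An≡1+v
  ... | a , b , a+b≡v , countA , countB | inj₂ (n , 1≤n , Bn≡1+v) =
    a , suc b , trans (+-suc a b) (cong suc a+b≡v) ,
    Aᵢ.count-at-nonterm countA (λ A[1+a]≡1+v → no-common-term A[1+a]≡1+v B[1+b]≡1+v) ,
    Bᵢ.count-at-term B[1+b]≡1+v
    where
    B[1+b]≡1+v : B (suc b) ≡ suc v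
    B[1+b]≡1+v = subst (λ j → B j ≡ suc v) (Bᵢ.count-next-index countB 1≤n Bn≡1+v) Bn≡1+v

  B-rank : ∀ m → 1 ≤ m → ∃ λ k → k + m ≡ B m × (k ≡ 0 ⊎ A k < B m) × B m < A (suc k)
  B-rank m 1≤m with counts (B m)
  ... | k , b , k+b≡Bm , (belowA , aboveA) , countB =
    k , subst (λ b → k + b ≡ B m) (Bᵢ.count-of-term 1≤m countB) k+b≡Bm , strictly belowA , aboveA
    where
    strictly : ∀ {k} → k ≡ 0 ⊎ A k ≤ B m → k ≡ 0 ⊎ A k < B m
    strictly {zero}  _            = inj₁ refl
    strictly {suc k} (inj₁ ())
    strictly {suc k} (inj₂ Ak≤Bm) = inj₂ (≤∧≢⇒< Ak≤Bm (proj₂ A∁B (suc k) m z<s 1≤m))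

module WindowArithmetic where
  open import Data.Nat
  open import Data.Nat.Properties
  open import Data.Nat.Tactic.RingSolver
  open import Data.List using (_∷_; [])
  open import Data.Product using (_×_; _,_)
  open import Data.Sum using (inj₁; inj₂)
  open import Relation.Binary.PropositionalEquality
  open ≤-Reasoning

  Between : ℕ → ℕ → ℕ → Set
  Between c d x = c ≤ x × x ≤ c + d

  2+2p≡2[1+p] : ∀ p → 2 + 2 * p ≡ 2 * suc p
  2+2p≡2[1+p] = solve-∀

  2[1+p]∸1≡1+2p : ∀ p → 2 * suc p ∸ 1 ≡ 1 + 2 * p
  2[1+p]∸1≡1+2p p = +-suc p (p + 0)

  7k≤a+4⇒a<k+m⇒6k<m+4 : ∀ k m a → 7 * k ≤ a + 4 → a < k + m → 6 * k < m + 4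
  7k≤a+4⇒a<k+m⇒6k<m+4 k m a 7k≤a+4 a<k+m = +-cancelˡ-< k (6 * k) (m + 4) (begin-strict
    k + 6 * k   ≡⟨ solve (k ∷ []) ⟩
    7 * k       ≤⟨ 7k≤a+4 ⟩
    a + 4       <⟨ +-monoˡ-< 4 a<k+m ⟩
    k + m + 4   ≡⟨ +-assoc k m 4 ⟩
    k + (m + 4) ∎)

  a+4≤7[1+k]+3⇒k+m<a⇒m<6[1+k] : ∀ k m a → a + 4 ≤ 7 * suc k + 3 → k + m < a → m < 6 * suc k
  a+4≤7[1+k]+3⇒k+m<a⇒m<6[1+k] k m a a+4≤7[1+k]+3 k+m<a =
    +-cancelʳ-≤ 3 (suc m) (6 * suc k) (+-cancelˡ-≤ (suc k) _ _ (begin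
      suc k + (suc m + 3)     ≡⟨ solve (k ∷ m ∷ []) ⟩
      suc (k + m) + 4         ≤⟨ +-monoˡ-≤ 4 k+m<a ⟩
      a + 4                   ≤⟨ a+4≤7[1+k]+3 ⟩
      7 * suc k + 3           ≡⟨ solve (k ∷ []) ⟩
      suc k + (6 * suc k + 3) ∎))

  m≤2+2p⇒6k<m+4⇒3k≤2+p : ∀ p k m → m ≤ 2 + 2 * p → 6 * k < m + 4 → 3 * k ≤ 2 + p
  m≤2+2p⇒6k<m+4⇒3k≤2+p p k m m≤2+2p 6k<m+4 = ≤-pred (*-cancelˡ-< 2 (3 * k) (3 + p) (begin-strict
    2 * (3 * k)   ≡⟨ solve (k ∷ []) ⟩
    6 * k         <⟨ 6k<m+4 ⟩
    m + 4         ≤⟨ +-monoˡ-≤ 4 m≤2+2p ⟩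
    2 + 2 * p + 4 ≡⟨ solve (p ∷ []) ⟩
    2 * (3 + p)   ∎))

  2x<6[1+k]⇒x≤2+3k : ∀ x k → 2 * x < 6 * suc k → x ≤ 2 + 3 * k
  2x<6[1+k]⇒x≤2+3k x k 2x<6[1+k] = ≤-pred (*-cancelˡ-< 2 x (3 + 3 * k) (begin-strict
    2 * x            <⟨ 2x<6[1+k] ⟩
    6 * suc k        ≡⟨ solve (k ∷ []) ⟩
    2 * (3 + 3 * k)  ∎))

  k+m<l+[1+m]⇒k≤l : ∀ k l m → k + m < l + suc m → k ≤ l
  k+m<l+[1+m]⇒k≤l k l m k+m<l+[1+m] =
    +-cancelʳ-≤ m k l (≤-pred (subst (k + m <_) (+-suc l m) k+m<l+[1+m]))

  offset-between : ∀ {x} p s d → x ≡ 7 + 6 * p + s → p ≤ s → s ≤ d + p → Between (7 * suc p) d x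
  offset-between {x} p s d x≡7+6p+s p≤s s≤d+p = lower , upper
    where
    lower : 7 * suc p ≤ x
    lower = begin
      7 * suc p     ≡⟨ solve (p ∷ []) ⟩
      7 + 6 * p + p ≤⟨ +-monoʳ-≤ (7 + 6 * p) p≤s ⟩
      7 + 6 * p + s ≡⟨ sym x≡7+6p+s ⟩
      x             ∎
    upper : x ≤ 7 * suc p + d
    upper = begin
      x                   ≡⟨ x≡7+6p+s ⟩
      7 + 6 * p + s       ≤⟨ +-monoʳ-≤ (7 + 6 * p) s≤d+p ⟩
      7 + 6 * p + (d + p) ≡⟨ solve (p ∷ d ∷ []) ⟩
      7 * suc p + d       ∎

  offsets⇒p≤1+2k₁+k₂≤3+p : ∀ {p k₁ k₂} → p ≤ 2 + 3 * k₁ → p ≤ 1 + 3 * k₂ → 3 * k₂ ≤ 2 + p → k₁ ≤ k₂ →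
                          p ≤ 1 + (2 * k₁ + k₂) × 1 + (2 * k₁ + k₂) ≤ 3 + p
  offsets⇒p≤1+2k₁+k₂≤3+p {p} {k₁} {k₂} p≤2+3k₁ p≤1+3k₂ 3k₂≤2+p k₁≤k₂ = lower , upper
    where
    -- when k₁ = k₂ the bound on k₁ is one too weak, and the bound on k₂ is used instead
    lower : p ≤ 1 + (2 * k₁ + k₂)
    lower with m≤n⇒m<n∨m≡n k₁≤k₂
    ... | inj₁ k₁<k₂ = begin
      p                       ≤⟨ p≤2+3k₁ ⟩
      2 + 3 * k₁              ≡⟨ solve (k₁ ∷ []) ⟩
      1 + (2 * k₁ + suc k₁)   ≤⟨ +-monoʳ-≤ 1 (+-monoʳ-≤ (2 * k₁) k₁<k₂) ⟩
      1 + (2 * k₁ + k₂)       ∎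
    ... | inj₂ refl = begin
      p                       ≤⟨ p≤1+3k₂ ⟩
      1 + 3 * k₂              ≡⟨ solve (k₂ ∷ []) ⟩
      1 + (2 * k₂ + k₂)       ∎
    upper : 1 + (2 * k₁ + k₂) ≤ 3 + p
    upper = begin
      1 + (2 * k₁ + k₂)       ≤⟨ +-monoʳ-≤ 1 (+-monoˡ-≤ k₂ (*-monoʳ-≤ 2 k₁≤k₂)) ⟩
      1 + (2 * k₂ + k₂)       ≡⟨ solve (k₂ ∷ []) ⟩
      1 + 3 * k₂              ≤⟨ s≤s 3k₂≤2+p ⟩
      3 + p                   ∎

module AntiJacobsthal
  {A B : ℕ → ℕ} (A-pos : PositiveSeq A) (B-pos : PositiveSeq B)
  (A-inc : StrictlyIncreasing A) (B-inc : StrictlyIncreasing B)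
  (A∁B : Complementary A B) (A-rec : AntiRecurrenceEq 2 jacobsthalForm A B) where
  open import Data.Nat
  open import Data.Nat.Properties
  open import Data.Nat.Tactic.RingSolver
  open import Data.List using (_∷_; [])
  open import Data.Product using (_×_; _,_; proj₁; proj₂; ∃)
  open import Data.Sum using (_⊎_; inj₁; inj₂)
  open import Relation.Nullary using (yes; no)
  open import Relation.Binary.PropositionalEquality
  open ComplementaryProperties A-pos B-pos A-inc B-inc A∁B
  open WindowArithmetic

  A≡2B¹+B² : ∀ p → A (suc p) ≡ 2 * B (1 + 2 * p) + B (2 + 2 * p)
  A≡2B¹+B² p = begin
    A (suc p)                                   ≡⟨ A-rec (suc p) z<s ⟩
    2 * B (p * 2 + 1) + (1 * B (p * 2 + 2) + 0) ≡⟨ cong₂ (λ i j → 2 * B i + (1 * B j + 0)) i₁ i₂ ⟩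
    2 * B (1 + 2 * p) + (1 * B (2 + 2 * p) + 0) ≡⟨ cong (2 * B (1 + 2 * p) +_) (trans (+-identityʳ _) (*-identityˡ _)) ⟩
    2 * B (1 + 2 * p) + B (2 + 2 * p)           ∎
    where
    open ≡-Reasoning
    i₁ : p * 2 + 1 ≡ 1 + 2 * p
    i₁ = solve (p ∷ [])
    i₂ : p * 2 + 2 ≡ 2 + 2 * p
    i₂ = solve (p ∷ [])

  B[1+2p]<A[1+p] : ∀ p → B (1 + 2 * p) < A (suc p)
  B[1+2p]<A[1+p] p = begin-strict
    b₁          <⟨ m<m+n b₁ (B-pos _ z<s) ⟩
    b₁ + b₂     ≤⟨ +-monoˡ-≤ b₂ (m≤n*m b₁ 2) ⟩
    2 * b₁ + b₂ ≡⟨ A≡2B¹+B² p ⟨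
    A (suc p)   ∎
    where
    open ≤-Reasoning
    b₁ = B (1 + 2 * p)
    b₂ = B (2 + 2 * p)

  B[2+2p]<A[1+p] : ∀ p → B (2 + 2 * p) < A (suc p)
  B[2+2p]<A[1+p] p = begin-strict
    b₂          <⟨ m<n+m b₂ (B-pos _ z<s) ⟩
    b₁ + b₂     ≤⟨ +-monoˡ-≤ b₂ (m≤n*m b₁ 2) ⟩
    2 * b₁ + b₂ ≡⟨ A≡2B¹+B² p ⟨
    A (suc p)   ∎
    where
    open ≤-Reasoning
    b₁ = B (1 + 2 * p)
    b₂ = B (2 + 2 * p)

  Window : ℕ → Set
  Window n = Between (7 * n) 3 (A n + 4)

  WindowsUpTo : ℕ → Set
  WindowsUpTo p = ∀ {j} → 1 ≤ j → j ≤ p → Window j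

  rank-bounds : ∀ {p m} → WindowsUpTo p → 1 ≤ m → m ≤ 2 + 2 * p → B m < A (suc p) →
                ∃ λ k → k + m ≡ B m × 3 * k ≤ 2 + p × m < 6 * suc k
  rank-bounds {p} {m} windows 1≤m m≤2+2p Bm<A[1+p] with B-rank m 1≤m
  ... | k , k+m≡Bm , below , above =
    k , k+m≡Bm , m≤2+2p⇒6k<m+4⇒3k≤2+p p k m m≤2+2p (upper k+m≡Bm below) , lower
    where
    open ≤-Reasoning
    upper : ∀ {k} → k + m ≡ B m → k ≡ 0 ⊎ A k < B m → 6 * k < m + 4
    upper {zero}  _ _         = <-≤-trans z<s (m≤n+m 4 m)
    upper {suc k} _ (inj₁ ())
    upper {suc k} k+m≡Bm (inj₂ Ak<Bm) =
      7k≤a+4⇒a<k+m⇒6k<m+4 (suc k) m (A (suc k))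
        (proj₁ (windows z<s (≤-pred (Aᵢ.cancel-< z<s (<-trans Ak<Bm Bm<A[1+p])))))
        (subst (A (suc k) <_) (sym k+m≡Bm) Ak<Bm)
    lower : m < 6 * suc k
    lower with suc k ≤? p
    ... | yes 1+k≤p =
      a+4≤7[1+k]+3⇒k+m<a⇒m<6[1+k] k m (A (suc k))
        (proj₂ (windows z<s 1+k≤p)) (subst (_< A (suc k)) (sym k+m≡Bm) above)
    ... | no 1+k≰p = begin-strict
      m                       ≤⟨ m≤2+2p ⟩
      2 + 2 * p               ≤⟨ +-monoʳ-≤ 2 (*-monoʳ-≤ 2 (≤-pred (≰⇒> 1+k≰p))) ⟩
      2 + 2 * k               <⟨ m<m+n (2 + 2 * k) z<s ⟩
      2 + 2 * k + (4 + 4 * k) ≡⟨ solve (k ∷ []) ⟩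
      6 * suc k               ∎

  -- for n = p + 1, k₁ and k₂ count the terms of A below B¹_n = B_{2p+1} and B²_n = B_{2p+2}
  record Offsets (p : ℕ) : Set where
    field
      k₁ k₂    : ℕ
      B¹≡      : k₁ + (1 + 2 * p) ≡ B (1 + 2 * p)
      B²≡      : k₂ + (2 + 2 * p) ≡ B (2 + 2 * p)
      k₁-lower : p ≤ 2 + 3 * k₁
      k₁-upper : 3 * k₁ ≤ 2 + p
      k₂-lower : p ≤ 1 + 3 * k₂
      k₂-upper : 3 * k₂ ≤ 2 + p
      k₁≤k₂    : k₁ ≤ k₂

  offsets : ∀ {p} → WindowsUpTo p → Offsets p
  offsets {p} windows
    with rank-bounds windows z<s (n≤1+n _) (B[1+2p]<A[1+p] p)
       | rank-bounds windows z<s ≤-refl (B[2+2p]<A[1+p] p)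
  ... | k₁ , B¹≡ , k₁-upper , 1+2p<6[1+k₁] | k₂ , B²≡ , k₂-upper , 2+2p<6[1+k₂] = record
    { k₁ = k₁ ; k₂ = k₂ ; B¹≡ = B¹≡ ; B²≡ = B²≡
    ; k₁-lower = 2x<6[1+k]⇒x≤2+3k p k₁ (<-trans (n<1+n _) 1+2p<6[1+k₁])
    ; k₁-upper = k₁-upper
    ; k₂-lower = ≤-pred (2x<6[1+k]⇒x≤2+3k (suc p) k₂ (subst (_< 6 * suc k₂) (2+2p≡2[1+p] p) 2+2p<6[1+k₂]))
    ; k₂-upper = k₂-upper
    ; k₁≤k₂ = k+m<l+[1+m]⇒k≤l k₁ k₂ (1 + 2 * p)
                (subst₂ _<_ (sym B¹≡) (sym B²≡) (B-inc (1 + 2 * p) (2 + 2 * p) z<s ≤-refl))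
    }

  window-suc : ∀ {p} → WindowsUpTo p → Window (suc p)
  window-suc {p} windows =
    offset-between p (1 + (2 * k₁ + k₂)) 3 A+4≡ (proj₁ bounds) (proj₂ bounds)
    where
    open Offsets (offsets windows)
    open ≡-Reasoning
    bounds = offsets⇒p≤1+2k₁+k₂≤3+p k₁-lower k₂-lower k₂-upper k₁≤k₂
    regroup : ∀ p k₁ k₂ → 2 * (k₁ + (1 + 2 * p)) + (k₂ + (2 + 2 * p)) + 4 ≡ 7 + 6 * p + (1 + (2 * k₁ + k₂))
    regroup = solve-∀
    A+4≡ : A (suc p) + 4 ≡ 7 + 6 * p + (1 + (2 * k₁ + k₂))
    A+4≡ = begin
      A (suc p) + 4                                         ≡⟨ cong (_+ 4) (A≡2B¹+B² p) ⟩
      2 * B (1 + 2 * p) + B (2 + 2 * p) + 4                 ≡⟨ cong₂ (λ b₁ b₂ → 2 * b₁ + b₂ + 4) B¹≡ B²≡ ⟨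
      2 * (k₁ + (1 + 2 * p)) + (k₂ + (2 + 2 * p)) + 4       ≡⟨ regroup p k₁ k₂ ⟩
      7 + 6 * p + (1 + (2 * k₁ + k₂))                       ∎

  windows : ∀ p → WindowsUpTo p
  windows zero    {suc _} _ ()
  windows (suc p) 1≤j j≤1+p with m≤n⇒m<n∨m≡n j≤1+p
  ... | inj₁ j<1+p = windows p 1≤j (≤-pred j<1+p)
  ... | inj₂ refl  = window-suc (windows p)

  A-window : ∀ n → 1 ≤ n → Window n
  A-window n 1≤n = windows n 1≤n ≤-refl

  B¹-window : ∀ n → 1 ≤ n → Between (7 * n) 4 (3 * B (2 * n ∸ 1) + 6)
  B¹-window (suc p) _ =
    subst (λ i → Between (7 * suc p) 4 (3 * B i + 6)) (sym (2[1+p]∸1≡1+2p p))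
      (offset-between p (2 + 3 * k₁) 4 3B+6≡ k₁-lower (+-monoʳ-≤ 2 k₁-upper))
    where
    open Offsets (offsets (windows p))
    open ≡-Reasoning
    regroup : ∀ p k → 3 * (k + (1 + 2 * p)) + 6 ≡ 7 + 6 * p + (2 + 3 * k)
    regroup = solve-∀
    3B+6≡ : 3 * B (1 + 2 * p) + 6 ≡ 7 + 6 * p + (2 + 3 * k₁)
    3B+6≡ = begin
      3 * B (1 + 2 * p) + 6          ≡⟨ cong (λ b → 3 * b + 6) B¹≡ ⟨
      3 * (k₁ + (1 + 2 * p)) + 6     ≡⟨ regroup p k₁ ⟩
      7 + 6 * p + (2 + 3 * k₁)       ∎

  B²-window : ∀ n → 1 ≤ n → Between (7 * n) 3 (3 * B (2 * n) + 2)
  B²-window (suc p) _ =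
    subst (λ i → Between (7 * suc p) 3 (3 * B i + 2)) (2+2p≡2[1+p] p)
      (offset-between p (1 + 3 * k₂) 3 3B+2≡ k₂-lower (s≤s k₂-upper))
    where
    open Offsets (offsets (windows p))
    open ≡-Reasoning
    regroup : ∀ p k → 3 * (k + (2 + 2 * p)) + 2 ≡ 7 + 6 * p + (1 + 3 * k)
    regroup = solve-∀
    3B+2≡ : 3 * B (2 + 2 * p) + 2 ≡ 7 + 6 * p + (1 + 3 * k₂)
    3B+2≡ = begin
      3 * B (2 + 2 * p) + 2          ≡⟨ cong (λ b → 3 * b + 2) B²≡ ⟨
      3 * (k₂ + (2 + 2 * p)) + 2     ≡⟨ regroup p k₂ ⟩
      7 + 6 * p + (1 + 3 * k₂)       ∎

-- ℕ's _+_ and _≤_ were kept inside the modules above: from here on they denote the integer operations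
open import Data.Nat using (_*_; _∸_) renaming (_≤_ to _≤ℕ_)
open import Data.Integer using (+_; _+_; _-_; _≤_; _⊖_; +≤+)
open import Data.Product using (_×_; _,_)

import Data.Nat as ℕ
open import Data.Nat.Properties using (m≤n+o⇒m∸n≤o)
open import Data.Integer.Properties using ([+m]-[+n]≡m⊖n; distribˡ-⊖-+-pos; ⊖-≥)
open import Relation.Binary.PropositionalEquality using (_≡_; cong; sym; subst; module ≡-Reasoning)
open WindowArithmetic using (Between)

Between⇒ℤ : ∀ {a b c d} → Between c d (a ℕ.+ b) → + 0 ≤ + a - + c + + b × + a - + c + + b ≤ + d
Between⇒ℤ {a} {b} {c} {d} (c≤a+b , a+b≤c+d) =
  subst (+ 0 ≤_) (sym shift) (+≤+ ℕ.z≤n) ,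
  subst (_≤ + d) (sym shift) (+≤+ (m≤n+o⇒m∸n≤o (a ℕ.+ b) c a+b≤c+d))
  where
  open ≡-Reasoning
  shift : + a - + c + + b ≡ + (a ℕ.+ b ∸ c)
  shift = begin
    + a - + c + + b ≡⟨ cong (_+ + b) ([+m]-[+n]≡m⊖n a c) ⟩
    a ⊖ c + + b     ≡⟨ distribˡ-⊖-+-pos b a c ⟩
    a ℕ.+ b ⊖ c     ≡⟨ ⊖-≥ c≤a+b ⟩
    + (a ℕ.+ b ∸ c) ∎

theorem6 : (A B : ℕ → ℕ) → IsAntiRecurrence 2 jacobsthalForm A B →
    ∀ n → 1 ≤ℕ n →
      (+ 0 ≤ + A n - + (7 * n) + + 4 × + A n - + (7 * n) + + 4 ≤ + 3)
      × (+ 0 ≤ + (3 * B (2 * n ∸ 1)) - + (7 * n) + + 6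
         × + (3 * B (2 * n ∸ 1)) - + (7 * n) + + 6 ≤ + 4)
      × (+ 0 ≤ + (3 * B (2 * n)) - + (7 * n) + + 2
         × + (3 * B (2 * n)) - + (7 * n) + + 2 ≤ + 3)
theorem6 A B (_ , _ , A-pos , B-pos , A-inc , B-inc , A∁B , A-rec) n 1≤n =
  Between⇒ℤ (A-window n 1≤n) , Between⇒ℤ (B¹-window n 1≤n) , Between⇒ℤ (B²-window n 1≤n)
  where
  open AntiJacobsthal A-pos B-pos A-inc B-inc A∁B A-rec
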